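{- Let $m>n$ be positive integers and let $G[V_1,V_2]$ be a balanced bipartite graph with $|V_1|=|V_2|=m+n-1$ and minimum degree $\delta(G)>\frac{3}{4}(m+n-1)$. Then for every red-blue-edge-coloring of $G$, either there is a red component $C$ with $|V(C)\cap V_1|\ge m$ and $|V(C)\cap V_2|\ge m$, or there is a blue component $C$ with $|V(C)\cap V_1|\ge n$ and $|V(C)\cap V_2|\ge n$.
   Context: For a red-blue-edge-colored graph $G$, a red (resp. blue) component is a connected component of the spanning subgraph of $G$ formed by all red (resp. blue) edges. -}

module Defs where

open import Data.Nat using (ℕ; _+_; _*_; _∸_; _<_; _≤_)
open import Data.Fin using (Fin)
open import Data.Bool using (Bool; true; false; T)
open import Data.Sum using (_⊎_; inj₁; inj₂)
open import Data.Product using (Σ; _×_; ∃-syntax)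
open import Data.List using (map; allFin)
open import Data.Nat.ListAction using (sum)
open import Data.Bool using (if_then_else_)
open import Data.Empty using (⊥)
open import Relation.Binary.Construct.Closure.ReflexiveTransitive using (Star)
open import Relation.Binary.PropositionalEquality using (_≡_)
open import Function.Definitions using (Injective)

-- A bipartite graph G[V₁,V₂] with |V₁| = |V₂| = N :
-- V₁ = Fin N (tagged inj₁), V₂ = Fin N (tagged inj₂);
-- adj i j = true iff there is an edge between i ∈ V₁ and j ∈ V₂.
BipGraph : ℕ → Set
BipGraph N = Fin N → Fin N → Bool

Vertex : ℕ → Set
Vertex N = Fin N ⊎ Fin N

deg₁ : ∀ {N} → BipGraph N → Fin N → ℕ
deg₁ {N} adj i = sum (map (λ j → if adj i j then 1 else 0) (allFin N))
deg₂ : ∀ {N} → BipGraph N → Fin N → ℕ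
deg₂ {N} adj j = sum (map (λ i → if adj i j then 1 else 0) (allFin N))

MinDegGt34 : ∀ {N} → BipGraph N → Set
MinDegGt34 {N} adj =
  ((i : Fin N) → 3 * N < 4 * deg₁ adj i) × ((j : Fin N) → 3 * N < 4 * deg₂ adj j)

data Colour : Set where
  red blue : Colour

-- A red-blue edge colouring: a colour for every pair (i,j); only the values
-- on actual edges (adj i j = true) matter.
Colouring : ℕ → Set
Colouring N = Fin N → Fin N → Colour

ColEdge : ∀ {N} → BipGraph N → Colouring N → Colour → Vertex N → Vertex N → Set
ColEdge adj col c (inj₁ i) (inj₂ j) = T (adj i j) × col i j ≡ c
ColEdge adj col c (inj₂ j) (inj₁ i) = T (adj i j) × col i j ≡ c
ColEdge adj col c (inj₁ _) (inj₁ _) = ⊥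
ColEdge adj col c (inj₂ _) (inj₂ _) = ⊥

SameComp : ∀ {N} → BipGraph N → Colouring N → Colour → Vertex N → Vertex N → Set
SameComp adj col c = Star (ColEdge adj col c)

-- There is a c-component C with |V(C) ∩ V₁| ≥ k and |V(C) ∩ V₂| ≥ k:
-- the component of some vertex v contains k distinct vertices of V₁
-- and k distinct vertices of V₂.
BigComp : ∀ {N} → BipGraph N → Colouring N → Colour → ℕ → Set
BigComp {N} adj col c k =
  Σ (Vertex N) λ v →
    (Σ (Fin k → Fin N) λ f → Injective _≡_ _≡_ f × ((t : Fin k) → SameComp adj col c v (inj₁ (f t))))
  × (Σ (Fin k → Fin N) λ g → Injective _≡_ _≡_ g × ((t : Fin k) → SameComp adj col c v (inj₂ (g t))))

-- Write N = m + n - 1, so that 2n ≤ N < 2m, and call a set of vertices on one side dense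
-- if it has more than 3N/4 elements; every neighbourhood is dense. Two dense sets meet inside
-- any N/2 vertices, and a dense set meets any N/4 vertices. Hence if no red edge joins a set U
-- of at least n vertices on one side to a set S of at least N/2 vertices on the other, then U
-- lies in a single blue component, which also contains all of S (if |U| ≥ N/4) or more than
-- N/4 > |U| neighbours of a vertex of U in S: a blue component with n vertices on each side.
-- Applied to the boundary of a red component R this shows that R has at least m vertices on
-- both sides, or some blue component is large, or R has fewer than n vertices on each side.
-- In the last case let x be a vertex of R and K its blue component. The edges from x to the
-- far side outside R are blue, so K has more than N/4 far vertices. If K had fewer than n near
-- vertices, the red component of a far vertex of K would contain every near vertex outside K,
-- hence would not be small; if K had fewer than n far vertices, R would contain every near
-- vertex of K. So K has at least n vertices on both sides.

module Submission where

open import Defs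
open import Data.Bool using (Bool; T; if_then_else_)
open import Data.Bool.Properties using (T?)
open import Data.Fin using (Fin; zero; suc; splitAt; join; fromℕ<; lift)
open import Data.Fin.Properties using (suc-injective; lift-injective; any?; splitAt-join) renaming (_≟_ to _≟ᶠ_)
open import Data.List using (map; allFin; tabulate; _∷_; [])
open import Data.List.Properties using (map-tabulate)
open import Data.Nat using (ℕ; zero; suc; _+_; _*_; _∸_; _≤_; _<_; _≤?_; z≤n; s≤s)
open import Data.Nat.ListAction using (sum)
open import Data.Nat.Properties
  using (≤-reflexive; ≤-trans; <-≤-trans; <-trans; <⇒≤; ≰⇒>; n≮n; <⇒≱;
         m≤n⇒m≤1+n; m<n⇒m<1+n; +-suc; +-comm; +-mono-≤; +-mono-<; +-monoˡ-≤; +-monoʳ-≤; ≮⇒≥; +-mono-<-≤; +-monoˡ-<;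
         +-cancelʳ-<; +-cancelʳ-≤; +-cancelˡ-≤; ≤-pred; *-monoʳ-≤; *-cancelˡ-<; *-distribˡ-+; m≤n+m; m∸n+n≡m;
         module ≤-Reasoning)
open import Data.Nat.Tactic.RingSolver using (solve)
open import Data.Product using (Σ-syntax; ∃; _×_; _,_)
open import Data.Sum using (_⊎_; inj₁; inj₂; [_,_]′) renaming (map to map-⊎)
open import Data.Sum.Properties using (≡-dec)
open import Function using (_∘_; flip)
open import Function.Definitions using (Injective)
open import Level using (Level; 0ℓ)
open import Relation.Binary using (Rel; DecidableEquality) renaming (Decidable to Decidable₂)
open import Relation.Binary.Construct.Closure.ReflexiveTransitive using (Star; ε; _◅_; _◅◅_)
open import Relation.Binary.PropositionalEquality using (_≡_; _≢_; refl; cong; sym; trans; subst)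
open import Relation.Nullary using (Dec; yes; no; ¬_; does; contradiction; _×-dec_; _⊎-dec_)
open import Relation.Nullary.Decidable using (map′; ¬?; decidable-stable)
open import Relation.Unary using (Pred; Decidable; _⊆_; _∩_; ∁)
open import Relation.Unary.Properties using (∁?; _∩?_)

private variable
  ℓ ℓ′ : Level
  N k : ℕ

count : {P : Pred (Fin N) ℓ} → Decidable P → ℕ
count {zero}  P? = 0
count {suc N} P? = (if does (P? zero) then 1 else 0) + count (P? ∘ suc)

count≤N : {P : Pred (Fin N) ℓ} (P? : Decidable P) → count P? ≤ N
count≤N {zero}  P? = z≤n
count≤N {suc N} P? with P? zero
... | yes _ = s≤s (count≤N (P? ∘ suc))
... | no  _ = m≤n⇒m≤1+n (count≤N (P? ∘ suc))

count+count-∁ : {P : Pred (Fin N) ℓ} (P? : Decidable P) → count P? + count (∁? P?) ≡ N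
count+count-∁ {zero}  P? = refl
count+count-∁ {suc N} P? with P? zero
... | yes _ = cong suc (count+count-∁ (P? ∘ suc))
... | no  _ = trans (+-suc _ _) (cong suc (count+count-∁ (P? ∘ suc)))

count-mono : {P : Pred (Fin N) ℓ} {Q : Pred (Fin N) ℓ′} (P? : Decidable P) (Q? : Decidable Q) →
             P ⊆ Q → count P? ≤ count Q?
count-mono {zero}  P? Q? P⊆Q = z≤n
count-mono {suc N} P? Q? P⊆Q with P? zero | Q? zero
... | yes p | yes _ = s≤s (count-mono (P? ∘ suc) (Q? ∘ suc) P⊆Q)
... | yes p | no ¬q = contradiction (P⊆Q p) ¬q
... | no  _ | yes _ = m≤n⇒m≤1+n (count-mono (P? ∘ suc) (Q? ∘ suc) P⊆Q)
... | no  _ | no  _ = count-mono (P? ∘ suc) (Q? ∘ suc) P⊆Q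

count-mono-< : {P : Pred (Fin N) ℓ} {Q : Pred (Fin N) ℓ′} (P? : Decidable P) (Q? : Decidable Q) →
               P ⊆ Q → ∀ i → Q i → ¬ P i → count P? < count Q?
count-mono-< {suc N} P? Q? P⊆Q zero qi ¬pi with P? zero | Q? zero
... | yes p | _     = contradiction p ¬pi
... | no  _ | yes _ = s≤s (count-mono (P? ∘ suc) (Q? ∘ suc) P⊆Q)
... | no  _ | no ¬q = contradiction qi ¬q
count-mono-< {suc N} P? Q? P⊆Q (suc i) qi ¬pi with P? zero | Q? zero
... | yes p | yes _ = s≤s (count-mono-< (P? ∘ suc) (Q? ∘ suc) P⊆Q i qi ¬pi)
... | yes p | no ¬q = contradiction (P⊆Q p) ¬q
... | no  _ | yes _ = m<n⇒m<1+n (count-mono-< (P? ∘ suc) (Q? ∘ suc) P⊆Q i qi ¬pi)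
... | no  _ | no  _ = count-mono-< (P? ∘ suc) (Q? ∘ suc) P⊆Q i qi ¬pi

count-∩ : {P : Pred (Fin N) ℓ} {Q : Pred (Fin N) ℓ′} (P? : Decidable P) (Q? : Decidable Q) →
          count P? + count Q? ≤ count (P? ∩? Q?) + N
count-∩ {zero}  P? Q? = z≤n
count-∩ {suc N} P? Q? with P? zero | Q? zero | count-∩ (P? ∘ suc) (Q? ∘ suc)
... | yes _ | yes _ | ih = s≤s (≤-trans (≤-reflexive (+-suc _ _)) (≤-trans (s≤s ih) (≤-reflexive (sym (+-suc _ N)))))
... | yes _ | no  _ | ih = ≤-trans (s≤s ih) (≤-reflexive (sym (+-suc _ N)))
... | no  _ | yes _ | ih = ≤-trans (≤-reflexive (+-suc _ _)) (≤-trans (s≤s ih) (≤-reflexive (sym (+-suc _ N))))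
... | no  _ | no  _ | ih = ≤-trans (m≤n⇒m≤1+n ih) (≤-reflexive (sym (+-suc _ N)))

count-witness : {P : Pred (Fin N) ℓ} (P? : Decidable P) → 0 < count P? → ∃ P
count-witness {suc N} P? pos with P? zero
... | yes p = zero , p
... | no  _ with count-witness (P? ∘ suc) pos
...   | i , p = suc i , p

count-embedding : {P : Pred (Fin N) ℓ} (P? : Decidable P) → k ≤ count P? →
                  Σ[ f ∈ (Fin k → Fin N) ] Injective _≡_ _≡_ f × (∀ t → P (f t))
count-embedding {k = zero}          P? _  = (λ ()) , (λ {}) , (λ ())
count-embedding {zero}  {k = suc k} P? ()
count-embedding {suc N} {k = suc k} {P = P} P? k≤ with P? zero
... | no _ with count-embedding (P? ∘ suc) k≤
...   | f , f-inj , Pf = suc ∘ f , f-inj ∘ suc-injective , Pf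
count-embedding {suc N} {k = suc k} {P = P} P? k≤ | yes p with count-embedding (P? ∘ suc) (≤-pred k≤)
...   | f , f-inj , Pf = lift 1 f , lift-injective f f-inj 1 , P-lift
  where
  P-lift : ∀ t → P (lift 1 f t)
  P-lift zero    = p
  P-lift (suc t) = Pf t

sum-indicator≡count : (b : Fin N → Bool) → sum (map (λ j → if b j then 1 else 0) (allFin N)) ≡ count (T? ∘ b)
sum-indicator≡count {N} b = trans (cong sum (map-tabulate (λ j → j) (λ j → if b j then 1 else 0))) (go b)
  where
  go : ∀ {N} (b : Fin N → Bool) → sum (tabulate (λ j → if b j then 1 else 0)) ≡ count (T? ∘ b)
  go {zero}  b = refl
  go {suc N} b = cong ((if b zero then 1 else 0) +_) (go (b ∘ suc))

module FiniteReachability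
  {V : Set} (_≟_ : DecidableEquality V)
  {k : ℕ} (enum : Fin k → V) (enum-surjective : ∀ v → ∃ λ i → enum i ≡ v)
  {R : Rel V 0ℓ} (R? : Decidable₂ R) where

  ∃? : {P : V → Set} → (∀ v → Dec (P v)) → Dec (∃ P)
  ∃? {P} P? = map′ (λ (i , p) → enum i , p)
                   (λ (v , p) → let (i , eq) = enum-surjective v in i , subst P (sym eq) p)
                   (any? (P? ∘ enum))

  Within : ℕ → V → V → Set
  Within zero    v w = v ≡ w
  Within (suc t) v w = Within t v w ⊎ ∃ λ u → Within t v u × R u w

  within? : ∀ t → Decidable₂ (Within t)
  within? zero    v w = v ≟ w
  within? (suc t) v w = within? t v w ⊎-dec ∃? (λ u → within? t v u ×-dec R? u w)

  within-refl : ∀ t {v} → Within t v v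
  within-refl zero    = refl
  within-refl (suc t) = inj₁ (within-refl t)

  within⇒star : ∀ t {v w} → Within t v w → Star R v w
  within⇒star zero    refl                  = ε
  within⇒star (suc t) (inj₁ p)              = within⇒star t p
  within⇒star (suc t) (inj₂ (u , p , r))    = within⇒star t p ◅◅ r ◅ ε

  Stable : ℕ → V → Set
  Stable t v = ∀ w → Within (suc t) v w → Within t v w

  stable-suc : ∀ {t v} → Stable t v → Stable (suc t) v
  stable-suc st w (inj₁ p)           = p
  stable-suc st w (inj₂ (u , p , r)) = inj₂ (u , st u p , r)

  stable-star : ∀ {t v u w} → Stable t v → Within t v u → Star R u w → Within t v w
  stable-star st p ε        = p
  stable-star st p (r ◅ rs) = stable-star st (st _ (inj₂ (_ , p , r))) rs

  reached : ℕ → V → ℕ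
  reached t v = count (λ i → within? t v (enum i))

  -- Until it stabilises, the set reached within t steps grows by a vertex at every step.
  stable-or-growing : ∀ t v → Stable t v ⊎ t ≤ reached t v
  stable-or-growing zero    v = inj₂ z≤n
  stable-or-growing (suc t) v with stable-or-growing t v
  ... | inj₁ st = inj₁ (stable-suc st)
  ... | inj₂ t≤ with any? (λ i → within? (suc t) v (enum i) ×-dec ¬? (within? t v (enum i)))
  ...   | yes (i , new , ¬old) = inj₂ (≤-trans (s≤s t≤) (count-mono-< _ _ inj₁ i new ¬old))
  ...   | no ¬new = inj₁ (stable-suc st)
    where
    st : Stable t v
    st w p with enum-surjective w
    ... | i , refl = decidable-stable (within? t v w) (λ ¬old → ¬new (i , p , ¬old))

  stable : ∀ v → Stable (suc k) v
  stable v with stable-or-growing (suc k) v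
  ... | inj₁ st = st
  ... | inj₂ k<  = contradiction (≤-trans k< (count≤N _)) (n≮n k)

  star? : Decidable₂ (Star R)
  star? v w = map′ (within⇒star (suc k)) (stable-star (stable v) (within-refl (suc k))) (within? (suc k) v w)

quarters-overlap : ∀ N a b → 3 * N < 4 * a → N ≤ 4 * b → N < a + b
quarters-overlap N a b 3N<4a N≤4b = *-cancelˡ-< 4 N (a + b) (begin-strict
  4 * N          ≡⟨ +-comm N (3 * N) ⟩
  3 * N + N      <⟨ +-mono-<-≤ 3N<4a N≤4b ⟩
  4 * a + 4 * b  ≡⟨ *-distribˡ-+ 4 a b ⟨
  4 * (a + b)    ∎)
  where open ≤-Reasoning

quarter-of-intersection : ∀ N a s c → 3 * N < 4 * a → N ≤ s + s → a + s ≤ c + N → N < 4 * c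
quarter-of-intersection N a s c 3N<4a N≤2s a+s≤c+N = +-cancelʳ-< (4 * N) N (4 * c) (begin-strict
  N + 4 * N          ≡⟨ solve (N ∷ []) ⟩
  3 * N + 2 * N      <⟨ +-mono-<-≤ 3N<4a (*-monoʳ-≤ 2 N≤2s) ⟩
  4 * a + 2 * (s + s) ≡⟨ solve (a ∷ s ∷ []) ⟩
  4 * (a + s)        ≤⟨ *-monoʳ-≤ 4 a+s≤c+N ⟩
  4 * (c + N)        ≡⟨ *-distribˡ-+ 4 c N ⟩
  4 * c + 4 * N      ∎)
  where open ≤-Reasoning

complement-of-small-half : ∀ {N} a a′ → a + a′ ≡ N → a + a < N → N ≤ a′ + a′
complement-of-small-half a a′ refl 2a<N = +-cancelˡ-≤ (a + a′) (a + a′) (a′ + a′) (begin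
  (a + a′) + (a + a′)  ≡⟨ solve (a ∷ a′ ∷ []) ⟩
  (a + a) + (a′ + a′)  ≤⟨ +-monoˡ-≤ (a′ + a′) (<⇒≤ 2a<N) ⟩
  (a + a′) + (a′ + a′) ∎)
  where open ≤-Reasoning

∁-half : {P : Pred (Fin N) ℓ} (P? : Decidable P) → count P? + count P? < N → N ≤ count (∁? P?) + count (∁? P?)
∁-half P? = complement-of-small-half (count P?) (count (∁? P?)) (count+count-∁ P?)

Dense : {P : Pred (Fin N) ℓ} → Decidable P → Set
Dense {N} P? = 3 * N < 4 * count P?

intersection-nonempty : {P : Pred (Fin N) ℓ} {Q : Pred (Fin N) ℓ′} (P? : Decidable P) (Q? : Decidable Q) →
                        N < count P? + count Q? → ∃ (P ∩ Q)
intersection-nonempty {N} P? Q? N<P+Q =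
  count-witness (P? ∩? Q?) (+-cancelʳ-< N 0 _ (<-≤-trans N<P+Q (count-∩ P? Q?)))

dense-meets-quarter : {A : Pred (Fin N) ℓ} {U : Pred (Fin N) ℓ′} (A? : Decidable A) (U? : Decidable U) →
                      Dense A? → N ≤ 4 * count U? → ∃ (A ∩ U)
dense-meets-quarter {N} A? U? dense N≤4U = intersection-nonempty A? U? (quarters-overlap N (count A?) (count U?) dense N≤4U)

dense-meets-half : {A : Pred (Fin N) ℓ} {S : Pred (Fin N) ℓ′} (A? : Decidable A) (S? : Decidable S) →
                   Dense A? → N ≤ count S? + count S? → N < 4 * count (A? ∩? S?)
dense-meets-half {N} A? S? dense N≤2S = quarter-of-intersection N (count A?) (count S?) (count (A? ∩? S?)) dense N≤2S (count-∩ A? S?)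

dense-dense-half-meet : {A B : Pred (Fin N) ℓ} {P : Pred (Fin N) ℓ′} (A? : Decidable A) (B? : Decidable B) (P? : Decidable P) →
                        Dense A? → Dense B? → N ≤ count P? + count P? → ∃ (A ∩ (B ∩ P))
dense-dense-half-meet A? B? P? denseA denseB N≤2P =
  dense-meets-quarter A? (B? ∩? P?) denseA (<⇒≤ (dense-meets-half B? P? denseB N≤2P))

positive-of-quarter : ∀ {N x} → N < 4 * x → 0 < x
positive-of-quarter {x = suc x} _ = s≤s z≤n

_≟ᶜ_ : DecidableEquality Colour
red  ≟ᶜ red  = yes refl
red  ≟ᶜ blue = no λ ()
blue ≟ᶜ red  = no λ ()
blue ≟ᶜ blue = yes refl

other : Colour → Colour
other red  = blue
other blue = red

≢⇒other : ∀ {c c′} → c′ ≢ c → c′ ≡ other c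
≢⇒other {red}  {red}  c≢c = contradiction refl c≢c
≢⇒other {red}  {blue} _   = refl
≢⇒other {blue} {red}  _   = refl
≢⇒other {blue} {blue} c≢c = contradiction refl c≢c

module Components {N : ℕ} (adj : BipGraph N) (col : Colouring N) where

  colEdge? : ∀ c → Decidable₂ (ColEdge adj col c)
  colEdge? c (inj₁ i) (inj₂ j) = T? (adj i j) ×-dec (col i j ≟ᶜ c)
  colEdge? c (inj₂ j) (inj₁ i) = T? (adj i j) ×-dec (col i j ≟ᶜ c)
  colEdge? c (inj₁ _) (inj₁ _) = no λ ()
  colEdge? c (inj₂ _) (inj₂ _) = no λ ()

  -- Abstract: letting the type checker unfold this decision procedure makes checking blow up.
  abstract
    sameComp? : ∀ c → Decidable₂ (SameComp adj col c)
    sameComp? c = star?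
      where open FiniteReachability (≡-dec _≟ᶠ_ _≟ᶠ_) (splitAt N) (λ v → join N N v , splitAt-join N N v) (colEdge? c)

  -- The bipartition seen from one of its sides: i ranges over the near side and j over the far
  -- side, adjacent i j and colour i j describing the pair (near i, far j). Lemmas are stated for
  -- an arbitrary Side and applied to opposite o to swap the roles of the two sides.
  record Side : Set where
    field
      near far   : Fin N → Vertex N
      adjacent   : Fin N → Fin N → Bool
      colour     : Fin N → Fin N → Colour
      edge       : ∀ {i j} → T (adjacent i j) → ColEdge adj col (colour i j) (near i) (far j)
      edge⁻¹     : ∀ {i j} → T (adjacent i j) → ColEdge adj col (colour i j) (far j) (near i)
      near-dense : ∀ i → Dense (λ j → T? (adjacent i j))
      far-dense  : ∀ j → Dense (λ i → T? (adjacent i j))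

    NearPart FarPart : Colour → Vertex N → Pred (Fin N) 0ℓ
    NearPart c v i = SameComp adj col c v (near i)
    FarPart  c v j = SameComp adj col c v (far j)

    nearPart? : ∀ c v → Decidable (NearPart c v)
    nearPart? c v = sameComp? c v ∘ near

    farPart? : ∀ c v → Decidable (FarPart c v)
    farPart? c v = sameComp? c v ∘ far

  opposite : Side → Side
  opposite o = record
    { near = far ; far = near ; adjacent = flip adjacent ; colour = flip colour
    ; edge = edge⁻¹ ; edge⁻¹ = edge ; near-dense = far-dense ; far-dense = near-dense }
    where open Side o

  V₁ : MinDegGt34 adj → Side
  V₁ (dense₁ , dense₂) = record
    { near = inj₁ ; far = inj₂ ; adjacent = adj ; colour = col
    ; edge = λ a → a , refl ; edge⁻¹ = λ a → a , refl
    ; near-dense = λ i → subst (λ d → 3 * N < 4 * d) (sum-indicator≡count (adj i)) (dense₁ i)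
    ; far-dense  = λ j → subst (λ d → 3 * N < 4 * d) (sum-indicator≡count (λ i → adj i j)) (dense₂ j) }

  Large : Side → Colour → ℕ → Set
  Large o c k = Σ[ v ∈ Vertex N ] k ≤ count (nearPart? c v) × k ≤ count (farPart? c v)
    where open Side o

  Large-opposite : ∀ {o c k} → Large (opposite o) c k → Large o c k
  Large-opposite (v , k≤far , k≤near) = v , k≤near , k≤far

  Large⇒BigComp : ∀ {md c k} → Large (V₁ md) c k → BigComp adj col c k
  Large⇒BigComp {md} {c} (v , k≤near , k≤far)
    with count-embedding (Side.nearPart? (V₁ md) c v) k≤near | count-embedding (Side.farPart? (V₁ md) c v) k≤far
  ... | f , f-inj , in-f | g , g-inj , in-g = v , (f , f-inj , in-f) , (g , g-inj , in-g)

  module _ (o : Side) where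
    open Side o

    coloured-edge : ∀ {c i j} → T (adjacent i j) → colour i j ≡ c → ColEdge adj col c (near i) (far j)
    coloured-edge a refl = edge a

    coloured-edge⁻¹ : ∀ {c i j} → T (adjacent i j) → colour i j ≡ c → ColEdge adj col c (far j) (near i)
    coloured-edge⁻¹ a refl = edge⁻¹ a

    boundary-colour : ∀ {c v i j} → NearPart c v i → ¬ FarPart c v j → T (adjacent i j) → colour i j ≡ other c
    boundary-colour v∼i v≁j a = ≢⇒other λ c-coloured → v≁j (v∼i ◅◅ coloured-edge a c-coloured ◅ ε)

    joined-through-half : ∀ {c i i′} {P : Pred (Fin N) 0ℓ} (P? : Decidable P) → N ≤ count P? + count P? →
                          (∀ {j} → P j → T (adjacent i j) → colour i j ≡ c) →
                          (∀ {j} → P j → T (adjacent i′ j) → colour i′ j ≡ c) →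
                          SameComp adj col c (near i) (near i′)
    joined-through-half {i = i} {i′} P? N≤2P c-from-i c-from-i′
      with dense-dense-half-meet (T? ∘ adjacent i) (λ j → T? (adjacent i′ j)) P? (near-dense i) (near-dense i′) N≤2P
    ... | j , a , a′ , pj = coloured-edge a (c-from-i pj a) ◅ coloured-edge⁻¹ a′ (c-from-i′ pj a′) ◅ ε

    joined-to-quarter : ∀ {c v j} {U : Pred (Fin N) 0ℓ} (U? : Decidable U) → N ≤ 4 * count U? → U ⊆ NearPart c v →
                        (∀ {i} → U i → T (adjacent i j) → colour i j ≡ c) → FarPart c v j
    joined-to-quarter {j = j} U? N≤4U U⊆C c-to-j with dense-meets-quarter (λ i → T? (adjacent i j)) U? (far-dense j) N≤4U
    ... | i , a , ui = U⊆C ui ◅◅ coloured-edge a (c-to-j ui a) ◅ ε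

    far-part-large : ∀ {c i} {S : Pred (Fin N) 0ℓ} (S? : Decidable S) → N ≤ count S? + count S? →
                     (∀ {j} → S j → T (adjacent i j) → colour i j ≡ c) → N < 4 * count (farPart? c (near i))
    far-part-large {i = i} S? N≤2S c-from-i =
      <-≤-trans (dense-meets-half (T? ∘ adjacent i) S? (near-dense i) N≤2S)
                (*-monoʳ-≤ 4 (count-mono ((T? ∘ adjacent i) ∩? S?) (farPart? _ (near i)) λ (a , sj) → coloured-edge a (c-from-i sj a) ◅ ε))

  module RedBlue {m n : ℕ} (N+1≡m+n : suc N ≡ m + n) (0<n : 0 < n) (n<m : n < m) where

    n+n≤N : n + n ≤ N
    n+n≤N = ≤-pred (≤-trans (+-monoˡ-< n n<m) (≤-reflexive (sym N+1≡m+n)))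

    ∁-half-of-small : {P : Pred (Fin N) 0ℓ} (P? : Decidable P) → count P? < n → N ≤ count (∁? P?) + count (∁? P?)
    ∁-half-of-small P? P<n = ∁-half P? (<-≤-trans (+-mono-< P<n P<n) n+n≤N)

    ≥m-of-∁-small : {P : Pred (Fin N) 0ℓ} (P? : Decidable P) → count (∁? P?) < n → m ≤ count P?
    ≥m-of-∁-small P? ∁P<n = +-cancelʳ-≤ n m (count P?) (begin
      m + n                       ≡⟨ N+1≡m+n ⟨
      suc N                       ≡⟨ cong suc (count+count-∁ P?) ⟨
      suc (count P? + count (∁? P?)) ≡⟨ +-suc (count P?) (count (∁? P?)) ⟨
      count P? + suc (count (∁? P?)) ≤⟨ +-monoʳ-≤ (count P?) ∁P<n ⟩
      count P? + n                ∎)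
      where open ≤-Reasoning

    ≥m⇒half : ∀ {a} → m ≤ a → N ≤ a + a
    ≥m⇒half m≤a = <⇒≤ (≤-trans (≤-reflexive N+1≡m+n) (≤-trans (+-monoʳ-≤ _ (<⇒≤ n<m)) (+-mono-≤ m≤a m≤a)))

    half⇒≥n : ∀ {s} → N ≤ s + s → n ≤ s
    half⇒≥n {s} N≤2s = ≮⇒≥ λ s<n → <⇒≱ (+-mono-< {s} {n} {s} {n} s<n s<n) (≤-trans n+n≤N N≤2s)

    RedOrBlue : Side → Set
    RedOrBlue o = Large o red m ⊎ Large o blue n

    RedOrBlue-opposite : ∀ {o} → RedOrBlue (opposite o) → RedOrBlue o
    RedOrBlue-opposite {o} = [ inj₁ ∘ Large-opposite {o} , inj₂ ∘ Large-opposite {o} ]′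

    SmallRed : Side → Vertex N → Set
    SmallRed o v = count (nearPart? red v) < n × count (farPart? red v) < n
      where open Side o

    module _ (o : Side) where
      open Side o

      blue-component : {U S : Pred (Fin N) 0ℓ} (U? : Decidable U) (S? : Decidable S) →
                       (∀ {i j} → U i → S j → T (adjacent i j) → colour i j ≡ blue) →
                       N ≤ count S? + count S? → n ≤ count U? → Large o blue n
      blue-component {U} U? S? blue-across N≤2S n≤U with count-witness U? (<-≤-trans 0<n n≤U)
      ... | i₀ , u₀ = near i₀ , n≤near , n≤far
        where
        U⊆K : U ⊆ NearPart blue (near i₀)
        U⊆K ui = joined-through-half o S? N≤2S (blue-across u₀) (blue-across ui)

        n≤near : n ≤ count (nearPart? blue (near i₀))
        n≤near = ≤-trans n≤U (count-mono U? (nearPart? blue (near i₀)) U⊆K)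

        n≤far : n ≤ count (farPart? blue (near i₀))
        n≤far with N ≤? 4 * count U?
        ... | yes N≤4U = ≤-trans (half⇒≥n N≤2S)
                           (count-mono S? (farPart? blue (near i₀)) λ sj → joined-to-quarter o U? N≤4U U⊆K (λ ui → blue-across ui sj))
        ... | no  N≰4U = ≤-trans n≤U (<⇒≤ (*-cancelˡ-< 4 (count U?) _ (<-trans (≰⇒> N≰4U) (far-part-large o S? N≤2S (blue-across u₀)))))

    module _ (o : Side) where
      open Side o

      red-part-≥m⇒red-or-blue : ∀ v → m ≤ count (nearPart? red v) → RedOrBlue o
      red-part-≥m⇒red-or-blue v m≤R₁ with n ≤? count (∁? (farPart? red v))
      ... | yes n≤∁R₂ = inj₂ (Large-opposite {o} (blue-component (opposite o) (∁? (farPart? red v)) (nearPart? red v)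
                                                    (λ j∉R i∈R a → boundary-colour o i∈R j∉R a) (≥m⇒half m≤R₁) n≤∁R₂))
      ... | no  n≰∁R₂ = inj₁ (v , m≤R₁ , ≥m-of-∁-small (farPart? red v) (≰⇒> n≰∁R₂))

      red-part-≥n⇒red-or-blue : ∀ v → n ≤ count (nearPart? red v) → RedOrBlue o
      red-part-≥n⇒red-or-blue v n≤R₁ with N ≤? count (farPart? red v) + count (farPart? red v)
      ... | no N≰2R₂ = inj₂ (blue-component o (nearPart? red v) (∁? (farPart? red v)) (boundary-colour o)
                               (∁-half (farPart? red v) (≰⇒> N≰2R₂)) n≤R₁)
      ... | yes N≤2R₂ with n ≤? count (∁? (nearPart? red v))
      ...   | yes n≤∁R₁ = inj₂ (blue-component o (∁? (nearPart? red v)) (farPart? red v)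
                                  (λ i∉R j∈R a → boundary-colour (opposite o) j∈R i∉R a) N≤2R₂ n≤∁R₁)
      ...   | no  n≰∁R₁ = red-part-≥m⇒red-or-blue v (≥m-of-∁-small (nearPart? red v) (≰⇒> n≰∁R₁))

    module _ (o : Side) where
      open Side o

      red-or-blue-or-small-red : ∀ v → RedOrBlue o ⊎ SmallRed o v
      red-or-blue-or-small-red v with n ≤? count (nearPart? red v) | n ≤? count (farPart? red v)
      ... | yes n≤R₁ | _        = inj₁ (red-part-≥n⇒red-or-blue o v n≤R₁)
      ... | no  _    | yes n≤R₂ = inj₁ (RedOrBlue-opposite {o} (red-part-≥n⇒red-or-blue (opposite o) v n≤R₂))
      ... | no  n≰R₁ | no  n≰R₂ = inj₂ (≰⇒> n≰R₁ , ≰⇒> n≰R₂)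

    module _ (o : Side) (x₀ : Fin N) where
      open Side o

      v₀ : Vertex N
      v₀ = near x₀

      blue-far-part-large : count (farPart? red v₀) < n → N < 4 * count (farPart? blue v₀)
      blue-far-part-large R₂<n =
        far-part-large o (∁? (farPart? red v₀)) (∁-half-of-small (farPart? red v₀) R₂<n) (boundary-colour o ε)

      blue-near-part-≥n-or-red-or-blue : N < 4 * count (farPart? blue v₀) → n ≤ count (nearPart? blue v₀) ⊎ RedOrBlue o
      blue-near-part-≥n-or-red-or-blue N<4K₂ with n ≤? count (nearPart? blue v₀)
      ... | yes n≤K₁ = inj₁ n≤K₁
      ... | no  n≰K₁ with count-witness (farPart? blue v₀) (positive-of-quarter N<4K₂)
      ...   | z₀ , z₀∈K with red-or-blue-or-small-red o (far z₀)
      ...     | inj₁ success    = inj₂ success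
      ...     | inj₂ (R′₁<n , _) =
        contradiction (≤-trans n≤∁K₁ (count-mono (∁? (nearPart? blue v₀)) (nearPart? red (far z₀)) ∁K₁⊆R′)) (<⇒≱ R′₁<n)
        where
        ∁K₁-half : N ≤ count (∁? (nearPart? blue v₀)) + count (∁? (nearPart? blue v₀))
        ∁K₁-half = ∁-half-of-small (nearPart? blue v₀) (≰⇒> n≰K₁)

        n≤∁K₁ : n ≤ count (∁? (nearPart? blue v₀))
        n≤∁K₁ = half⇒≥n ∁K₁-half

        K₂⊆R′ : FarPart blue v₀ ⊆ FarPart red (far z₀)
        K₂⊆R′ z∈K = joined-through-half (opposite o) (∁? (nearPart? blue v₀)) ∁K₁-half
                      (boundary-colour (opposite o) z₀∈K) (boundary-colour (opposite o) z∈K)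

        ∁K₁⊆R′ : ∁ (NearPart blue v₀) ⊆ NearPart red (far z₀)
        ∁K₁⊆R′ y∉K = joined-to-quarter (opposite o) (farPart? blue v₀) (<⇒≤ N<4K₂) K₂⊆R′
                       (λ z∈K → boundary-colour (opposite o) z∈K y∉K)

      blue-far-part-≥n : count (nearPart? red v₀) < n → n ≤ count (nearPart? blue v₀) → n ≤ count (farPart? blue v₀)
      blue-far-part-≥n R₁<n n≤K₁ with n ≤? count (farPart? blue v₀)
      ... | yes n≤K₂ = n≤K₂
      ... | no  n≰K₂ = contradiction (≤-trans n≤K₁ (count-mono (nearPart? blue v₀) (nearPart? red v₀) K₁⊆R₀)) (<⇒≱ R₁<n)
        where
        K₁⊆R₀ : NearPart blue v₀ ⊆ NearPart red v₀
        K₁⊆R₀ y∈K = joined-through-half o (∁? (farPart? blue v₀)) (∁-half-of-small (farPart? blue v₀) (≰⇒> n≰K₂))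
                      (boundary-colour o ε) (boundary-colour o y∈K)

      red-or-blue : RedOrBlue o
      red-or-blue with red-or-blue-or-small-red o v₀
      ... | inj₁ success = success
      ... | inj₂ (R₁<n , R₂<n) with blue-near-part-≥n-or-red-or-blue (blue-far-part-large R₂<n)
      ...   | inj₁ n≤K₁ = inj₂ (v₀ , n≤K₁ , blue-far-part-≥n R₁<n n≤K₁)
      ...   | inj₂ success = success

lemma2p1 : (m n : ℕ) → 0 < n → n < m →
           (adj : BipGraph (m + n ∸ 1)) → MinDegGt34 adj →
           (col : Colouring (m + n ∸ 1)) →
           BigComp adj col red m ⊎ BigComp adj col blue n
lemma2p1 m n 0<n n<m adj md col =
  map-⊎ (Large⇒BigComp {md}) (Large⇒BigComp {md}) (red-or-blue (V₁ md) x₀)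
  where
  open Components adj col
  N+1≡m+n : suc (m + n ∸ 1) ≡ m + n
  N+1≡m+n = trans (+-comm 1 _) (m∸n+n≡m (≤-trans 0<n (m≤n+m n m)))
  open RedBlue N+1≡m+n 0<n n<m
  x₀ : Fin (m + n ∸ 1)
  x₀ = fromℕ< (<-≤-trans (<-≤-trans 0<n (m≤n+m n n)) n+n≤N)
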